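{- Let $k,m$ be positive integers, $n=k+m$, let $Q$ be the complete bipartite poset of type $(k,m)$, $A=\{x_{k+1},\dots,x_n\}$, $M=\mathbf{I}(Q,A)$ with unit group $G$. Let $L$ satisfy $[k]\subseteq L\subset[n]$. Then the $\mathcal{H}$-class of $\mathbf{1}_L$ in $M$ is $$\mathbf{1}_LG\mathbf{1}_L=\left\{\begin{bmatrix}\mathbf{1}_k&B\\0&D\end{bmatrix}: B\in\mathrm{Mat}_{k,m}\text{ with }B\widetilde{\mathbf{1}_L}=B,\ D\in\overline{\mathbf{T}}_L\right\}.$$
   Context: Work over $\mathbb{C}$. The complete bipartite poset of type $(k,m)$ is $Q=\{x_1,\dots,x_n\}$ with $x_i<x_j$ iff $i\le k<j$, no other strict relations. $M=\mathbf{I}(Q,A)=\{\begin{bmatrix}\mathbf{1}_k&B\\0&D\end{bmatrix}: B\in\mathrm{Mat}_{k,m},\ D\text{ diagonal }m\times m\}$ is the Zariski closure of $\mathbf{T}_n(A)\ltimes\mathbf{U}_n(Q)$ (invertible diagonal matrices with first $k$ entries $1$, times upper unitriangular matrices supported on the relations of $Q$); its unit group $G$ consists of those elements with $D$ invertible. For $L\subseteq[n]$, $\mathbf{1}_L=\mathrm{diag}(a_1,\dots,a_n)$ with $a_j=1$ if $j\in L$ and $0$ otherwise; $\widetilde{\mathbf{1}_L}=\mathrm{diag}(a_{k+1},\dots,a_n)$; $\overline{\mathbf{T}}_L$ is the set of $m\times m$ diagonal matrices $D$ such that $D=D'\widetilde{\mathbf{1}_L}$ for some invertible $m\times m$ diagonal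 matrix $D'$. -}

module Defs where

open import Level using (Level; _⊔_)
open import Algebra.Bundles using (CommutativeRing)
open import Data.Nat as ℕ using (ℕ; zero; suc)
open import Data.Fin as Fin using (Fin; splitAt; _↑ˡ_; _↑ʳ_)
open import Data.Bool using (Bool; true; false; if_then_else_)
open import Data.Sum using (inj₁; inj₂)
open import Data.Product using (Σ; ∃; ∃-syntax; _×_; _,_)
open import Relation.Nullary using (¬_; yes; no)
open import Relation.Binary.PropositionalEquality using (_≡_; _≢_)

record Field (c ℓ : Level) : Set (Level.suc (c ⊔ ℓ)) where
  field
    commutativeRing : CommutativeRing c ℓ
  open CommutativeRing commutativeRing public
  field
    1≉0     : ¬ (1# ≈ 0#)
    inverse : ∀ x → ¬ (x ≈ 0#) → ∃[ y ] (x * y ≈ 1#)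

module MatrixDefs {c ℓ : Level} (F : Field c ℓ) where
  open Field F using (Carrier; _≈_; _+_; _*_; 0#; 1#)

  Mat : ℕ → ℕ → Set c
  Mat r s = Fin r → Fin s → Carrier

  _≈M_ : ∀ {r s} → Mat r s → Mat r s → Set ℓ
  X ≈M Y = ∀ i j → X i j ≈ Y i j

  ∑ : ∀ {n} → (Fin n → Carrier) → Carrier
  ∑ {zero}  f = 0#
  ∑ {suc n} f = f Fin.zero + ∑ (λ i → f (Fin.suc i))

  _·_ : ∀ {r s t} → Mat r s → Mat s t → Mat r t
  (X · Y) i j = ∑ (λ l → X i l * Y l j)

  δ : ∀ {n} → Fin n → Fin n → Carrier
  δ i j with i Fin.≟ j
  ... | yes _ = 1#
  ... | no  _ = 0#

  𝟙 : ∀ n → Mat n n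
  𝟙 n = δ

  Diagonal : ∀ {n} → Mat n n → Set ℓ
  Diagonal {n} D = ∀ (i j : Fin n) → i ≢ j → D i j ≈ 0#

  Invertible : ∀ {n} → Mat n n → Set (c ⊔ ℓ)
  Invertible {n} X = ∃[ Y ] ((X · Y) ≈M 𝟙 n × (Y · X) ≈M 𝟙 n)

  diag : ∀ {n} → (Fin n → Carrier) → Mat n n
  diag a i j with i Fin.≟ j
  ... | yes _ = a i
  ... | no  _ = 0#

  Subset : ℕ → Set
  Subset n = Fin n → Bool

  bit : Bool → Carrier
  bit b = if b then 1# else 0#

  𝟏 : ∀ {n} → Subset n → Mat n n
  𝟏 L = diag (λ j → bit (L j))

  block : ∀ {k m} → Mat k m → Mat m m → Mat (k ℕ.+ m) (k ℕ.+ m)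
  block {k} {m} B D i j with splitAt k i | splitAt k j
  ... | inj₁ i' | inj₁ j' = δ i' j'
  ... | inj₁ i' | inj₂ j' = B i' j'
  ... | inj₂ i' | inj₁ j' = 0#
  ... | inj₂ i' | inj₂ j' = D i' j'

  module Bipartite (k m : ℕ) where
    n : ℕ
    n = k ℕ.+ m

    -- M = I(Q,A) for the complete bipartite poset of type (k,m), A = {x_{k+1},…,x_n}
    InM : Mat n n → Set (c ⊔ ℓ)
    InM X = ∃[ B ] ∃[ D ] (Diagonal D × X ≈M block {k} {m} B D)

    InG : Mat n n → Set (c ⊔ ℓ)
    InG X = InM X × ∃[ Y ] (InM Y × (X · Y) ≈M 𝟙 n × (Y · X) ≈M 𝟙 n)

    ℋ : Mat n n → Mat n n → Set (c ⊔ ℓ)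
    ℋ X Y = (∃[ U ] (InM U × X ≈M (Y · U))) × (∃[ V ] (InM V × Y ≈M (X · V)))
          × (∃[ U ] (InM U × X ≈M (U · Y))) × (∃[ V ] (InM V × Y ≈M (V · X)))

    InHClass : Mat n n → Mat n n → Set (c ⊔ ℓ)
    InHClass E X = InM X × ℋ X E

    InEGE : Subset n → Mat n n → Set (c ⊔ ℓ)
    InEGE L X = ∃[ g ] (InG g × X ≈M ((𝟏 L · g) · 𝟏 L))

    𝟏~ : Subset n → Mat m m
    𝟏~ L = diag (λ j → bit (L (k ↑ʳ j)))

    InTbar : Subset n → Mat m m → Set (c ⊔ ℓ)
    InTbar L D = Diagonal D × ∃[ D' ] (Diagonal D' × Invertible D' × D ≈M (D' · 𝟏~ L))

    InRHS : Subset n → Mat n n → Set (c ⊔ ℓ)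
    InRHS L X = ∃[ B ] ∃[ D ] (X ≈M block {k} {m} B D × (B · 𝟏~ L) ≈M B × InTbar L D)

    Admissible : Subset n → Set
    Admissible L = (∀ (i : Fin k) → L (i ↑ˡ m) ≡ true) × ∃[ j ] (L j ≡ false)

    SameSet : (Mat n n → Set (c ⊔ ℓ)) → (Mat n n → Set (c ⊔ ℓ)) → Set (c ⊔ ℓ)
    SameSet P R = ∀ X → (P X → R X) × (R X → P X)

{-# OPTIONS --safe #-}
-- Every element of M is a block matrix [1 B; 0 diag d], and these multiply as
-- [1 B; 0 d] [1 B′; 0 d′] = [1, B′ + B d′; 0, d d′]. Since [k] ⊆ L, 𝟏_L = [1 0; 0 diag e] with e the
-- 0/1 indicator of L on the last m coordinates, so every membership reduces to identities between entries.
-- If X ℋ 𝟏_L, then X = U 𝟏_L gives B = B e and d = w e, while 𝟏_L = X V gives e = d v: the entries of d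
-- are units on L and vanish off L, so d = d′ e for an entrywise invertible d′. Conversely, for
-- X = [1 B; 0 d′ e] with B = B e, the inverse V of the unit g = [1 B; 0 d′] satisfies X V = V X = 𝟏_L,
-- and X = 𝟏_L g 𝟏_L.
module Submission where

open import Defs
open import Level using (Level; _⊔_)
open import Data.Nat as ℕ using (ℕ; NonZero)
open import Data.Bool using (true; false)
open import Data.Empty using (⊥-elim)
open import Data.Fin as Fin using (Fin; _↑ˡ_; _↑ʳ_)
open import Data.Fin.Properties
  using (splitAt-↑ˡ; splitAt-↑ʳ; splitAt⁻¹-↑ˡ; splitAt⁻¹-↑ʳ; ↑ˡ-injective; ↑ʳ-injective; suc-injective)
open import Data.Product using (∃-syntax; ∃₂; Σ-syntax; _×_; _,_; proj₁; proj₂)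
open import Data.Sum using (inj₁; inj₂)
import Data.Vec.Functional.Relation.Binary.Equality.Setoid as VectorSetoid
open import Function using (_∘_)
open import Function.Definitions using (Injective)
open import Relation.Binary.Bundles using (Setoid)
open import Relation.Binary.PropositionalEquality as ≡ using (_≡_; _≢_)
import Relation.Binary.Reasoning.Setoid as SetoidReasoning
open import Relation.Nullary using (yes; no)

module MatrixProperties {c ℓ : Level} (F : Field c ℓ) where
  open Field F
  open MatrixDefs F
  open import Algebra.Properties.Ring ring using (-‿distribˡ-*)
  open import Algebra.Solver.Ring.NaturalCoefficients.Default commutativeSemiring

  matSetoid : ℕ → ℕ → Setoid c ℓ
  matSetoid r s = VectorSetoid.≋-setoid (VectorSetoid.≋-setoid setoid s) r

  module _ {r s : ℕ} where
    open Setoid (matSetoid r s) public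
      using () renaming (refl to ≈M-refl; sym to ≈M-sym; trans to ≈M-trans)

  module ≈-Reasoning = SetoidReasoning setoid
  module ≈M-Reasoning (r s : ℕ) = SetoidReasoning (matSetoid r s)

  ∑-cong : ∀ {p} {f g : Fin p → Carrier} → (∀ i → f i ≈ g i) → ∑ f ≈ ∑ g
  ∑-cong {ℕ.zero}  f≈g = refl
  ∑-cong {ℕ.suc p} f≈g = +-cong (f≈g Fin.zero) (∑-cong (f≈g ∘ Fin.suc))

  ∑-zero : ∀ {p} {f : Fin p → Carrier} → (∀ i → f i ≈ 0#) → ∑ f ≈ 0#
  ∑-zero {ℕ.zero}  f≈0 = refl
  ∑-zero {ℕ.suc p} f≈0 = trans (+-cong (f≈0 Fin.zero) (∑-zero (f≈0 ∘ Fin.suc))) (+-identityˡ 0#)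

  ∑-single : ∀ {p} {f : Fin p → Carrier} (j : Fin p) → (∀ i → i ≢ j → f i ≈ 0#) → ∑ f ≈ f j
  ∑-single Fin.zero    f≈0 = trans (+-congˡ (∑-zero λ i → f≈0 (Fin.suc i) λ ())) (+-identityʳ _)
  ∑-single (Fin.suc j) f≈0 = trans (+-congʳ (f≈0 Fin.zero λ ())) (trans (+-identityˡ _)
    (∑-single j λ i i≢j → f≈0 (Fin.suc i) (i≢j ∘ suc-injective)))

  ∑-split : ∀ a {b} (f : Fin (a ℕ.+ b) → Carrier) →
            ∑ f ≈ ∑ (λ i → f (i ↑ˡ b)) + ∑ (λ j → f (a ↑ʳ j))
  ∑-split ℕ.zero    f = sym (+-identityˡ _)
  ∑-split (ℕ.suc a) f = trans (+-congˡ (∑-split a (f ∘ Fin.suc))) (sym (+-assoc _ _ _))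

  ·-cong : ∀ {r s t} {X X′ : Mat r s} {Y Y′ : Mat s t} → X ≈M X′ → Y ≈M Y′ → (X · Y) ≈M (X′ · Y′)
  ·-cong X≈X′ Y≈Y′ i j = ∑-cong λ l → *-cong (X≈X′ i l) (Y≈Y′ l j)

  module _ {p : ℕ} where

    diag-refl : ∀ (a : Fin p → Carrier) i → diag a i i ≈ a i
    diag-refl a i with i Fin.≟ i
    ... | yes _   = refl
    ... | no  i≢i = ⊥-elim (i≢i ≡.refl)

    diag-≢ : ∀ (a : Fin p → Carrier) {i j} → i ≢ j → diag a i j ≈ 0#
    diag-≢ a {i} {j} i≢j with i Fin.≟ j
    ... | yes i≡j = ⊥-elim (i≢j i≡j)
    ... | no  _   = refl

    diag-diagonal : ∀ (a : Fin p → Carrier) → Diagonal (diag a)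
    diag-diagonal a i j = diag-≢ a

    diag-cong : ∀ {a b : Fin p → Carrier} → (∀ i → a i ≈ b i) → diag a ≈M diag b
    diag-cong a≈b i j with i Fin.≟ j
    ... | yes _ = a≈b i
    ... | no  _ = refl

    diag-injective : ∀ {a b : Fin p → Carrier} → diag a ≈M diag b → ∀ i → a i ≈ b i
    diag-injective {a} {b} a≈b i = trans (sym (diag-refl a i)) (trans (a≈b i i) (diag-refl b i))

    diagonal≈diag : ∀ {D : Mat p p} → Diagonal D → D ≈M diag (λ i → D i i)
    diagonal≈diag D-diag i j with i Fin.≟ j
    ... | yes ≡.refl = refl
    ... | no  i≢j    = D-diag i j i≢j

    𝟙≈diag : 𝟙 p ≈M diag (λ _ → 1#)
    𝟙≈diag i j with i Fin.≟ j
    ... | yes _ = refl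
    ... | no  _ = refl

    diag-*ʳ : ∀ (a b : Fin p → Carrier) i j → diag a i j * b j ≈ diag (λ l → a l * b l) i j
    diag-*ʳ a b i j with i Fin.≟ j
    ... | yes ≡.refl = refl
    ... | no  _      = zeroˡ (b j)

  diag-reindex : ∀ {p q} (f : Fin p → Fin q) → Injective _≡_ _≡_ f →
                 ∀ (a : Fin q → Carrier) i j → diag a (f i) (f j) ≈ diag (a ∘ f) i j
  diag-reindex f f-inj a i j with i Fin.≟ j
  ... | yes ≡.refl = diag-refl a (f i)
  ... | no  i≢j    = diag-≢ a (i≢j ∘ f-inj)

  ·-diag : ∀ {r s} (X : Mat r s) (b : Fin s → Carrier) → (X · diag b) ≈M (λ i j → X i j * b j)
  ·-diag X b i j = trans (∑-single j λ l l≢j → trans (*-congˡ (diag-≢ b l≢j)) (zeroʳ _))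
                         (*-congˡ (diag-refl b j))

  diag-· : ∀ {r s} (a : Fin r → Carrier) (X : Mat r s) → (diag a · X) ≈M (λ i j → a i * X i j)
  diag-· a X i j = trans (∑-single i λ l l≢i → trans (*-congʳ (diag-≢ a (l≢i ∘ ≡.sym))) (zeroˡ _))
                         (*-congʳ (diag-refl a i))

  diag-·-diag : ∀ {p} (a b : Fin p → Carrier) → (diag a · diag b) ≈M diag (λ i → a i * b i)
  diag-·-diag a b i j = trans (·-diag (diag a) b i j) (diag-*ʳ a b i j)

  diag-invertible : ∀ {p} {a b : Fin p → Carrier} → (∀ i → a i * b i ≈ 1#) → Invertible (diag a)
  diag-invertible {p} {a} {b} ab≈1 =
    diag b , diag-inverse a b ab≈1 , diag-inverse b a (λ i → trans (*-comm _ _) (ab≈1 i))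
    where
    diag-inverse : ∀ x y → (∀ i → x i * y i ≈ 1#) → (diag x · diag y) ≈M 𝟙 p
    diag-inverse x y xy≈1 = ≈M-trans (diag-·-diag x y) (≈M-trans (diag-cong xy≈1) (≈M-sym 𝟙≈diag))

  diagonal-invertible⇒units : ∀ {p} {D : Mat p p} → Diagonal D → Invertible D →
                               ∃[ u ] ∀ i → D i i * u i ≈ 1#
  diagonal-invertible⇒units {p} {D} D-diag (Y , DY≈𝟙 , _) = (λ i → Y i i) , λ i → begin
    D i i * Y i i                 ≈⟨ diag-· (λ l → D l l) Y i i ⟨
    (diag (λ l → D l l) · Y) i i  ≈⟨ ·-cong {Y = Y} (≈M-sym (diagonal≈diag D-diag)) ≈M-refl i i ⟩
    (D · Y) i i                   ≈⟨ DY≈𝟙 i i ⟩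
    𝟙 p i i                       ≈⟨ 𝟙≈diag i i ⟩
    diag (λ _ → 1#) i i           ≈⟨ diag-refl _ i ⟩
    1#                            ∎
    where open ≈-Reasoning

  0M : ∀ {r s} → Mat r s
  0M _ _ = 0#

  𝟙-· : ∀ {r s} (X : Mat r s) → (𝟙 r · X) ≈M X
  𝟙-· X i j = trans (·-cong {Y = X} 𝟙≈diag ≈M-refl i j) (trans (diag-· _ X i j) (*-identityˡ _))

  0-· : ∀ {r s t} (X : Mat s t) → (0M {r} · X) ≈M 0M
  0-· X i j = ∑-zero λ l → zeroˡ (X l j)

  ·-0 : ∀ {r s t} (X : Mat r s) → (X · 0M {s} {t}) ≈M 0M
  ·-0 X i j = ∑-zero λ l → zeroʳ (X i l)

  bit-idem : ∀ b → bit b * bit b ≈ bit b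
  bit-idem true  = *-identityˡ 1#
  bit-idem false = zeroˡ 0#

  bit-absorbs : ∀ b {x w} → x ≈ w * bit b → x * bit b ≈ x
  bit-absorbs b {x} {w} x≈wb = begin
    x * bit b            ≈⟨ *-congʳ x≈wb ⟩
    w * bit b * bit b    ≈⟨ *-assoc w (bit b) (bit b) ⟩
    w * (bit b * bit b)  ≈⟨ *-congˡ (bit-idem b) ⟩
    w * bit b            ≈⟨ x≈wb ⟨
    x                    ∎
    where open ≈-Reasoning

  -- x′ is x on L and 1 off L, where x vanishes.
  bit-unit-factor : ∀ b {x w v} → x ≈ w * bit b → bit b ≈ x * v →
                    ∃₂ λ x′ u → x ≈ x′ * bit b × x′ * u ≈ 1#
  bit-unit-factor true  {x} {v = v} _ b≈xv = x , v , sym (*-identityʳ x) , sym b≈xv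
  bit-unit-factor false {w = w} x≈w0 _ =
    1# , 1# , trans x≈w0 (trans (zeroʳ w) (sym (zeroʳ 1#))) , *-identityˡ 1#

  -x⁻¹d≈-x : ∀ x {d u} → d * u ≈ 1# → - (x * u) * d ≈ - x
  -x⁻¹d≈-x x {d} {u} du≈1 = begin
    - (x * u) * d   ≈⟨ -‿distribˡ-* _ _ ⟨
    - (x * u * d)   ≈⟨ -‿cong (solve 3 (λ x u d → x :* u :* d := x :* (d :* u)) refl x u d) ⟩
    - (x * (d * u)) ≈⟨ -‿cong (*-congˡ du≈1) ⟩
    - (x * 1#)      ≈⟨ -‿cong (*-identityʳ x) ⟩
    - x             ∎
    where open ≈-Reasoning

  module Blocks (k m : ℕ) where
    open Bipartite k m

    block-↑ˡ-↑ˡ : ∀ (B : Mat k m) D i j → block B D (i ↑ˡ m) (j ↑ˡ m) ≈ 𝟙 k i j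
    block-↑ˡ-↑ˡ B D i j rewrite splitAt-↑ˡ k i m | splitAt-↑ˡ k j m = refl

    block-↑ˡ-↑ʳ : ∀ (B : Mat k m) D i j → block B D (i ↑ˡ m) (k ↑ʳ j) ≈ B i j
    block-↑ˡ-↑ʳ B D i j rewrite splitAt-↑ˡ k i m | splitAt-↑ʳ k m j = refl

    block-↑ʳ-↑ˡ : ∀ (B : Mat k m) D i j → block B D (k ↑ʳ i) (j ↑ˡ m) ≈ 0#
    block-↑ʳ-↑ˡ B D i j rewrite splitAt-↑ʳ k m i | splitAt-↑ˡ k j m = refl

    block-↑ʳ-↑ʳ : ∀ (B : Mat k m) D i j → block B D (k ↑ʳ i) (k ↑ʳ j) ≈ D i j
    block-↑ʳ-↑ʳ B D i j rewrite splitAt-↑ʳ k m i | splitAt-↑ʳ k m j = refl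

    ↑ˡ≢↑ʳ : ∀ (i : Fin k) (j : Fin m) → i ↑ˡ m ≢ k ↑ʳ j
    ↑ˡ≢↑ʳ i j eq with ≡.trans (≡.sym (splitAt-↑ˡ k i m)) (≡.trans (≡.cong (Fin.splitAt k) eq) (splitAt-↑ʳ k m j))
    ... | ()

    splitAt-elim : ∀ {a} (P : Fin n → Set a) → (∀ i → P (i ↑ˡ m)) → (∀ j → P (k ↑ʳ j)) → ∀ p → P p
    splitAt-elim P left right p with Fin.splitAt k p in eq
    ... | inj₁ i = ≡.subst P (splitAt⁻¹-↑ˡ eq) (left i)
    ... | inj₂ j = ≡.subst P (splitAt⁻¹-↑ʳ eq) (right j)

    byBlocks : ∀ {X Y : Mat n n} →
      (∀ i j → X (i ↑ˡ m) (j ↑ˡ m) ≈ Y (i ↑ˡ m) (j ↑ˡ m)) →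
      (∀ i j → X (i ↑ˡ m) (k ↑ʳ j) ≈ Y (i ↑ˡ m) (k ↑ʳ j)) →
      (∀ i j → X (k ↑ʳ i) (j ↑ˡ m) ≈ Y (k ↑ʳ i) (j ↑ˡ m)) →
      (∀ i j → X (k ↑ʳ i) (k ↑ʳ j) ≈ Y (k ↑ʳ i) (k ↑ʳ j)) →
      X ≈M Y
    byBlocks {X} {Y} ll lr rl rr =
      splitAt-elim (λ p → ∀ q → X p q ≈ Y p q)
        (λ i → splitAt-elim (λ q → X (i ↑ˡ m) q ≈ Y (i ↑ˡ m) q) (ll i) (lr i))
        (λ i → splitAt-elim (λ q → X (k ↑ʳ i) q ≈ Y (k ↑ʳ i) q) (rl i) (rr i))

    block-injective : ∀ {B B′ D D′} → block B D ≈M block B′ D′ → B ≈M B′ × D ≈M D′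
    block-injective {B} {B′} {D} {D′} eq =
      (λ i j → trans (sym (block-↑ˡ-↑ʳ B D i j)) (trans (eq _ _) (block-↑ˡ-↑ʳ B′ D′ i j))) ,
      (λ i j → trans (sym (block-↑ʳ-↑ʳ B D i j)) (trans (eq _ _) (block-↑ʳ-↑ʳ B′ D′ i j)))

    block-cong : ∀ {B B′ D D′} → B ≈M B′ → D ≈M D′ → block B D ≈M block B′ D′
    block-cong {B} {B′} {D} {D′} B≈B′ D≈D′ = byBlocks
      (λ i j → trans (block-↑ˡ-↑ˡ B D i j) (sym (block-↑ˡ-↑ˡ B′ D′ i j)))
      (λ i j → trans (block-↑ˡ-↑ʳ B D i j) (trans (B≈B′ i j) (sym (block-↑ˡ-↑ʳ B′ D′ i j))))
      (λ i j → trans (block-↑ʳ-↑ˡ B D i j) (sym (block-↑ʳ-↑ˡ B′ D′ i j)))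
      (λ i j → trans (block-↑ʳ-↑ʳ B D i j) (trans (D≈D′ i j) (sym (block-↑ʳ-↑ʳ B′ D′ i j))))

    block-·-block : ∀ B D B′ D′ →
      (block B D · block B′ D′) ≈M block (λ i j → B′ i j + (B · D′) i j) (D · D′)
    block-·-block B D B′ D′ = byBlocks
      (λ i j → begin
        _                              ≈⟨ ∑-split k _ ⟩
        _                              ≈⟨ +-cong (∑-cong λ l → *-cong (block-↑ˡ-↑ˡ B D i l) (block-↑ˡ-↑ˡ B′ D′ l j))
                                                 (∑-cong λ l → *-cong (block-↑ˡ-↑ʳ B D i l) (block-↑ʳ-↑ˡ B′ D′ l j)) ⟩
        (𝟙 k · 𝟙 k) i j + (B · 0M) i j ≈⟨ +-cong (𝟙-· (𝟙 k) i j) (·-0 B i j) ⟩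
        𝟙 k i j + 0#                   ≈⟨ +-identityʳ _ ⟩
        𝟙 k i j                        ≈⟨ block-↑ˡ-↑ˡ _ _ i j ⟨
        _                              ∎)
      (λ i j → begin
        _                               ≈⟨ ∑-split k _ ⟩
        _                               ≈⟨ +-cong (∑-cong λ l → *-cong (block-↑ˡ-↑ˡ B D i l) (block-↑ˡ-↑ʳ B′ D′ l j))
                                                  (∑-cong λ l → *-cong (block-↑ˡ-↑ʳ B D i l) (block-↑ʳ-↑ʳ B′ D′ l j)) ⟩
        (𝟙 k · B′) i j + (B · D′) i j   ≈⟨ +-congʳ (𝟙-· B′ i j) ⟩
        B′ i j + (B · D′) i j           ≈⟨ block-↑ˡ-↑ʳ _ _ i j ⟨
        _                               ∎)
      (λ i j → begin
        _                               ≈⟨ ∑-split k _ ⟩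
        _                               ≈⟨ +-cong (∑-cong λ l → *-cong (block-↑ʳ-↑ˡ B D i l) (block-↑ˡ-↑ˡ B′ D′ l j))
                                                  (∑-cong λ l → *-cong (block-↑ʳ-↑ʳ B D i l) (block-↑ʳ-↑ˡ B′ D′ l j)) ⟩
        (0M · 𝟙 k) i j + (D · 0M) i j   ≈⟨ +-cong (0-· (𝟙 k) i j) (·-0 D i j) ⟩
        0# + 0#                         ≈⟨ +-identityʳ 0# ⟩
        0#                              ≈⟨ block-↑ʳ-↑ˡ _ _ i j ⟨
        _                               ∎)
      (λ i j → begin
        _                               ≈⟨ ∑-split k _ ⟩
        _                               ≈⟨ +-cong (∑-cong λ l → *-cong (block-↑ʳ-↑ˡ B D i l) (block-↑ˡ-↑ʳ B′ D′ l j))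
                                                  (∑-cong λ l → *-cong (block-↑ʳ-↑ʳ B D i l) (block-↑ʳ-↑ʳ B′ D′ l j)) ⟩
        (0M · B′) i j + (D · D′) i j    ≈⟨ +-congʳ (0-· B′ i j) ⟩
        0# + (D · D′) i j               ≈⟨ +-identityˡ _ ⟩
        (D · D′) i j                    ≈⟨ block-↑ʳ-↑ʳ _ _ i j ⟨
        _                               ∎)
      where open ≈-Reasoning

    blockᵈ : Mat k m → (Fin m → Carrier) → Mat n n
    blockᵈ B d = block B (diag d)

    blockᵈ∈M : ∀ B d → InM (blockᵈ B d)
    blockᵈ∈M B d = B , diag d , diag-diagonal d , ≈M-refl

    InM⇒blockᵈ : ∀ {X} → InM X → ∃₂ λ B d → X ≈M blockᵈ B d
    InM⇒blockᵈ (B , D , D-diag , X≈) =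
      B , (λ j → D j j) , ≈M-trans X≈ (block-cong ≈M-refl (diagonal≈diag D-diag))

    blockᵈ-cong : ∀ {B B′ d d′} → B ≈M B′ → (∀ j → d j ≈ d′ j) → blockᵈ B d ≈M blockᵈ B′ d′
    blockᵈ-cong B≈B′ d≈d′ = block-cong B≈B′ (diag-cong d≈d′)

    blockᵈ-injective : ∀ {B B′ d d′} → blockᵈ B d ≈M blockᵈ B′ d′ → B ≈M B′ × (∀ j → d j ≈ d′ j)
    blockᵈ-injective eq = proj₁ (block-injective eq) , diag-injective (proj₂ (block-injective eq))

    blockᵈ-·-blockᵈ : ∀ B d B′ d′ →
      (blockᵈ B d · blockᵈ B′ d′) ≈M blockᵈ (λ i j → B′ i j + B i j * d′ j) (λ j → d j * d′ j)
    blockᵈ-·-blockᵈ B d B′ d′ = ≈M-trans (block-·-block B (diag d) B′ (diag d′))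
      (block-cong (λ i j → +-congˡ (·-diag B d′ i j)) (diag-·-diag d d′))

    diag≈blockᵈ : ∀ {a : Fin n → Carrier} → (∀ i → a (i ↑ˡ m) ≈ 1#) →
                  diag a ≈M blockᵈ 0M (λ j → a (k ↑ʳ j))
    diag≈blockᵈ {a} a≈1 = byBlocks
      (λ i j → begin
        diag a (i ↑ˡ m) (j ↑ˡ m)       ≈⟨ diag-reindex (_↑ˡ m) (λ {x} {y} → ↑ˡ-injective m x y) a i j ⟩
        diag (λ l → a (l ↑ˡ m)) i j    ≈⟨ diag-cong a≈1 i j ⟩
        diag (λ _ → 1#) i j            ≈⟨ 𝟙≈diag i j ⟨
        𝟙 k i j                        ≈⟨ block-↑ˡ-↑ˡ _ _ i j ⟨
        _                              ∎)
      (λ i j → trans (diag-≢ a (↑ˡ≢↑ʳ i j)) (sym (block-↑ˡ-↑ʳ _ _ i j)))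
      (λ i j → trans (diag-≢ a (↑ˡ≢↑ʳ j i ∘ ≡.sym)) (sym (block-↑ʳ-↑ˡ _ _ i j)))
      (λ i j → trans (diag-reindex (k ↑ʳ_) (λ {x} {y} → ↑ʳ-injective k x y) a i j)
                     (sym (block-↑ʳ-↑ʳ _ _ i j)))
      where open ≈-Reasoning

    𝟙≈blockᵈ : 𝟙 n ≈M blockᵈ 0M (λ _ → 1#)
    𝟙≈blockᵈ = ≈M-trans 𝟙≈diag (diag≈blockᵈ λ _ → refl)

    blockᵈ-inverse : ∀ B {d u} → (∀ j → d j * u j ≈ 1#) →
      let B⁻ = λ i j → - (B i j * u j) in
      (blockᵈ B d · blockᵈ B⁻ u) ≈M 𝟙 n × (blockᵈ B⁻ u · blockᵈ B d) ≈M 𝟙 n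
    blockᵈ-inverse B du≈1 =
      ≈M-trans (blockᵈ-·-blockᵈ _ _ _ _)
        (≈M-trans (blockᵈ-cong (λ i j → -‿inverseˡ _) du≈1) (≈M-sym 𝟙≈blockᵈ)) ,
      ≈M-trans (blockᵈ-·-blockᵈ _ _ _ _)
        (≈M-trans (blockᵈ-cong (λ i j → trans (+-congˡ (-x⁻¹d≈-x (B i j) (du≈1 j))) (-‿inverseʳ _))
                               (λ j → trans (*-comm _ _) (du≈1 j)))
                  (≈M-sym 𝟙≈blockᵈ))

    blockᵈ∈G : ∀ B {d u} → (∀ j → d j * u j ≈ 1#) → InG (blockᵈ B d)
    blockᵈ∈G B {d} {u} du≈1 =
      blockᵈ∈M B d , _ , blockᵈ∈M (λ i j → - (B i j * u j)) u , blockᵈ-inverse B du≈1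

    G⇒blockᵈ : ∀ {g} → InG g → ∃[ B ] ∃₂ λ d u → g ≈M blockᵈ B d × (∀ j → d j * u j ≈ 1#)
    G⇒blockᵈ {g} (g∈M , Y , Y∈M , gY≈𝟙 , _)
      with B , d , g≈ ← InM⇒blockᵈ g∈M | B′ , d′ , Y≈ ← InM⇒blockᵈ Y∈M =
      B , d , d′ , g≈ , proj₂ (blockᵈ-injective (begin
        blockᵈ _ (λ j → d j * d′ j)  ≈⟨ blockᵈ-·-blockᵈ B d B′ d′ ⟨
        blockᵈ B d · blockᵈ B′ d′    ≈⟨ ·-cong (≈M-sym g≈) (≈M-sym Y≈) ⟩
        g · Y                        ≈⟨ gY≈𝟙 ⟩
        𝟙 n                          ≈⟨ 𝟙≈blockᵈ ⟩
        blockᵈ 0M (λ _ → 1#)         ∎))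
      where open ≈M-Reasoning n n

    module Idempotent (L : Subset n) (k⊆L : ∀ i → L (i ↑ˡ m) ≡ true) where

      e : Fin m → Carrier
      e j = bit (L (k ↑ʳ j))

      e-absorbs : ∀ x j → x * e j * e j ≈ x * e j
      e-absorbs x j = bit-absorbs (L (k ↑ʳ j)) refl

      𝟏≈blockᵈ : 𝟏 L ≈M blockᵈ 0M e
      𝟏≈blockᵈ = diag≈blockᵈ λ i → reflexive (≡.cong bit (k⊆L i))

      𝟏-·-blockᵈ : ∀ B d → (𝟏 L · blockᵈ B d) ≈M blockᵈ B (λ j → e j * d j)
      𝟏-·-blockᵈ B d = ≈M-trans (·-cong {Y = blockᵈ B d} 𝟏≈blockᵈ ≈M-refl)
        (≈M-trans (blockᵈ-·-blockᵈ 0M e B d)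
                  (blockᵈ-cong (λ i j → trans (+-congˡ (zeroˡ (d j))) (+-identityʳ _)) λ _ → refl))

      blockᵈ-·-𝟏 : ∀ B d → (blockᵈ B d · 𝟏 L) ≈M blockᵈ (λ i j → B i j * e j) (λ j → d j * e j)
      blockᵈ-·-𝟏 B d = ≈M-trans (·-cong {X = blockᵈ B d} ≈M-refl 𝟏≈blockᵈ)
        (≈M-trans (blockᵈ-·-blockᵈ B d 0M e) (blockᵈ-cong (λ i j → +-identityˡ _) λ _ → refl))

      𝟏-sandwich : ∀ B d → ((𝟏 L · blockᵈ B d) · 𝟏 L) ≈M blockᵈ (λ i j → B i j * e j) (λ j → d j * e j)
      𝟏-sandwich B d = ≈M-trans (·-cong {Y = 𝟏 L} (𝟏-·-blockᵈ B d) ≈M-refl)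
        (≈M-trans (blockᵈ-·-𝟏 B _)
                  (blockᵈ-cong ≈M-refl λ j → trans (*-congʳ (*-comm (e j) (d j))) (e-absorbs (d j) j)))

      InRHSᵈ : Mat n n → Set (c ⊔ ℓ)
      InRHSᵈ X = Σ[ B ∈ Mat k m ] Σ[ d ∈ (Fin m → Carrier) ] Σ[ u ∈ (Fin m → Carrier) ]
        X ≈M blockᵈ B (λ j → d j * e j) × (∀ i j → B i j * e j ≈ B i j) × (∀ j → d j * u j ≈ 1#)

      RHS⇒RHSᵈ : ∀ {X} → InRHS L X → InRHSᵈ X
      RHS⇒RHSᵈ (B , D , X≈ , BE≈B , D-diag , D′ , D′-diag , D′-inv , D≈D′E)
        with u , d′u≈1 ← diagonal-invertible⇒units D′-diag D′-inv =
        B , (λ j → D′ j j) , u ,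
        ≈M-trans X≈ (block-cong ≈M-refl (≈M-trans D≈D′E (≈M-trans D′E≈ (diag-·-diag _ e)))) ,
        (λ i j → trans (sym (·-diag B e i j)) (BE≈B i j)) ,
        d′u≈1
        where
        D′E≈ : (D′ · 𝟏~ L) ≈M (diag (λ j → D′ j j) · 𝟏~ L)
        D′E≈ = ·-cong {Y = 𝟏~ L} (diagonal≈diag D′-diag) ≈M-refl

      RHSᵈ⇒RHS : ∀ {X} → InRHSᵈ X → InRHS L X
      RHSᵈ⇒RHS (B , d , u , X≈ , Be≈B , du≈1) =
        B , _ , X≈ , (λ i j → trans (·-diag B e i j) (Be≈B i j)) ,
        diag-diagonal _ , diag d , diag-diagonal d , diag-invertible du≈1 , ≈M-sym (diag-·-diag d e)

      EGE⇒RHSᵈ : ∀ {X} → InEGE L X → InRHSᵈ X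
      EGE⇒RHSᵈ (g , g∈G , X≈𝟏g𝟏) with B , d , u , g≈ , du≈1 ← G⇒blockᵈ g∈G =
        (λ i j → B i j * e j) , d , u ,
        ≈M-trans X≈𝟏g𝟏 (≈M-trans (·-cong {Y = 𝟏 L} (·-cong {X = 𝟏 L} ≈M-refl g≈) ≈M-refl) (𝟏-sandwich B d)) ,
        (λ i j → e-absorbs (B i j) j) ,
        du≈1

      RHSᵈ⇒EGE : ∀ {X} → InRHSᵈ X → InEGE L X
      RHSᵈ⇒EGE (B , d , u , X≈ , Be≈B , du≈1) =
        blockᵈ B d , blockᵈ∈G B du≈1 ,
        ≈M-trans X≈ (≈M-trans (blockᵈ-cong (λ i j → sym (Be≈B i j)) (λ _ → refl)) (≈M-sym (𝟏-sandwich B d)))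

      H⇒RHSᵈ : ∀ {X} → InHClass (𝟏 L) X → InRHSᵈ X
      H⇒RHSᵈ {X} (X∈M , _ , (V , V∈M , 𝟏≈XV) , (U , U∈M , X≈U𝟏) , _)
        with B , d , X≈ ← InM⇒blockᵈ X∈M
           | B′ , v , V≈ ← InM⇒blockᵈ V∈M
           | B″ , w , U≈ ← InM⇒blockᵈ U∈M =
        B , d′ , u , ≈M-trans X≈ (blockᵈ-cong ≈M-refl d≈d′e) , (λ i j → bit-absorbs _ (proj₁ X≈U𝟏ᵈ i j)) , d′u≈1
        where
        open ≈M-Reasoning n n
        X≈U𝟏ᵈ : B ≈M (λ i j → B″ i j * e j) × (∀ j → d j ≈ w j * e j)
        X≈U𝟏ᵈ = blockᵈ-injective (begin
          blockᵈ B d           ≈⟨ X≈ ⟨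
          X                    ≈⟨ X≈U𝟏 ⟩
          U · 𝟏 L              ≈⟨ ·-cong {Y = 𝟏 L} U≈ ≈M-refl ⟩
          blockᵈ B″ w · 𝟏 L    ≈⟨ blockᵈ-·-𝟏 B″ w ⟩
          blockᵈ _ _           ∎)
        𝟏≈XVᵈ : 0M ≈M (λ i j → B′ i j + B i j * v j) × (∀ j → e j ≈ d j * v j)
        𝟏≈XVᵈ = blockᵈ-injective (begin
          blockᵈ 0M e                ≈⟨ 𝟏≈blockᵈ ⟨
          𝟏 L                        ≈⟨ 𝟏≈XV ⟩
          X · V                      ≈⟨ ·-cong X≈ V≈ ⟩
          blockᵈ B d · blockᵈ B′ v   ≈⟨ blockᵈ-·-blockᵈ B d B′ v ⟩
          blockᵈ _ _                 ∎)
        factor : ∀ j → ∃₂ λ x′ y → d j ≈ x′ * e j × x′ * y ≈ 1#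
        factor j = bit-unit-factor (L (k ↑ʳ j)) (proj₂ X≈U𝟏ᵈ j) (proj₂ 𝟏≈XVᵈ j)
        d′ u : Fin m → Carrier
        d′ = proj₁ ∘ factor
        u = proj₁ ∘ proj₂ ∘ factor
        d≈d′e : ∀ j → d j ≈ d′ j * e j
        d≈d′e = proj₁ ∘ proj₂ ∘ proj₂ ∘ factor
        d′u≈1 : ∀ j → d′ j * u j ≈ 1#
        d′u≈1 = proj₂ ∘ proj₂ ∘ proj₂ ∘ factor

      𝟏-·-blockᵈ-absorbs : ∀ B (d : Fin m → Carrier) → (𝟏 L · blockᵈ B (λ j → d j * e j)) ≈M blockᵈ B (λ j → d j * e j)
      𝟏-·-blockᵈ-absorbs B d = ≈M-trans (𝟏-·-blockᵈ B _)
        (blockᵈ-cong ≈M-refl λ j → trans (*-comm (e j) _) (e-absorbs (d j) j))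

      blockᵈ-·-𝟏-absorbs : ∀ {B} (d : Fin m → Carrier) → (∀ i j → B i j * e j ≈ B i j) →
                           (blockᵈ B (λ j → d j * e j) · 𝟏 L) ≈M blockᵈ B (λ j → d j * e j)
      blockᵈ-·-𝟏-absorbs {B} d Be≈B = ≈M-trans (blockᵈ-·-𝟏 B _) (blockᵈ-cong Be≈B λ j → e-absorbs (d j) j)

      blockᵈ-·-inverse≈𝟏 : ∀ {B} {d u : Fin m → Carrier} → (∀ i j → B i j * e j ≈ B i j) → (∀ j → d j * u j ≈ 1#) →
        let X = blockᵈ B (λ j → d j * e j) ; V = blockᵈ (λ i j → - (B i j * u j)) u in
        (X · V) ≈M 𝟏 L × (V · X) ≈M 𝟏 L
      blockᵈ-·-inverse≈𝟏 {B} {d} {u} Be≈B du≈1 =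
        ≈M-trans (blockᵈ-·-blockᵈ _ _ _ _)
          (≈M-trans (blockᵈ-cong (λ i j → -‿inverseˡ _) deu≈e) (≈M-sym 𝟏≈blockᵈ)) ,
        ≈M-trans (blockᵈ-·-blockᵈ _ _ _ _)
          (≈M-trans (blockᵈ-cong (λ i j → trans (+-congˡ (B⁻de≈-B i j)) (-‿inverseʳ _))
                                 (λ j → trans (*-comm _ _) (deu≈e j)))
                    (≈M-sym 𝟏≈blockᵈ))
        where
        deu≈e : ∀ j → d j * e j * u j ≈ e j
        deu≈e j = trans (solve 3 (λ d e u → d :* e :* u := d :* u :* e) refl (d j) (e j) (u j))
                        (trans (*-congʳ (du≈1 j)) (*-identityˡ (e j)))
        B⁻de≈-B : ∀ i j → - (B i j * u j) * (d j * e j) ≈ - B i j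
        B⁻de≈-B i j = trans (sym (*-assoc _ _ _)) (trans (*-congʳ (-x⁻¹d≈-x (B i j) (du≈1 j)))
                        (trans (sym (-‿distribˡ-* _ _)) (-‿cong (Be≈B i j))))

      RHSᵈ⇒H : ∀ {X} → InRHSᵈ X → InHClass (𝟏 L) X
      RHSᵈ⇒H {X} (B , d , u , X≈ , Be≈B , du≈1) =
        X∈M , (X , X∈M , X≈𝟏X) , (V , V∈M , 𝟏≈XV) , (X , X∈M , X≈X𝟏) , (V , V∈M , 𝟏≈VX)
        where
        open ≈M-Reasoning n n
        V : Mat n n
        V = blockᵈ (λ i j → - (B i j * u j)) u
        X∈M : InM X
        X∈M = B , _ , diag-diagonal _ , X≈
        V∈M : InM V
        V∈M = blockᵈ∈M _ u
        X≈𝟏X : X ≈M (𝟏 L · X)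
        X≈𝟏X = begin
          X                                     ≈⟨ X≈ ⟩
          blockᵈ B _                            ≈⟨ 𝟏-·-blockᵈ-absorbs B d ⟨
          𝟏 L · blockᵈ B (λ j → d j * e j)      ≈⟨ ·-cong {X = 𝟏 L} ≈M-refl X≈ ⟨
          𝟏 L · X                               ∎
        X≈X𝟏 : X ≈M (X · 𝟏 L)
        X≈X𝟏 = begin
          X                                     ≈⟨ X≈ ⟩
          blockᵈ B _                            ≈⟨ blockᵈ-·-𝟏-absorbs d Be≈B ⟨
          blockᵈ B (λ j → d j * e j) · 𝟏 L      ≈⟨ ·-cong {Y = 𝟏 L} X≈ ≈M-refl ⟨
          X · 𝟏 L                               ∎
        𝟏≈XV : 𝟏 L ≈M (X · V)
        𝟏≈XV = ≈M-trans (≈M-sym (proj₁ (blockᵈ-·-inverse≈𝟏 Be≈B du≈1))) (·-cong {Y = V} (≈M-sym X≈) ≈M-refl)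
        𝟏≈VX : 𝟏 L ≈M (V · X)
        𝟏≈VX = ≈M-trans (≈M-sym (proj₂ (blockᵈ-·-inverse≈𝟏 Be≈B du≈1))) (·-cong {X = V} ≈M-refl (≈M-sym X≈))

open import Data.Nat using (_+_)

proposition5p5 : ∀ {c ℓ : Level} (F : Field c ℓ) (k m : ℕ) → NonZero k → NonZero m →
    let open MatrixDefs F in
    let open Bipartite k m in
    ∀ (L : Subset (k + m)) → Admissible L →
    SameSet (InHClass (𝟏 L)) (InEGE L) × SameSet (InEGE L) (InRHS L)
proposition5p5 F k m _ _ L (k⊆L , _) =
  (λ _ → RHSᵈ⇒EGE ∘ H⇒RHSᵈ , RHSᵈ⇒H ∘ EGE⇒RHSᵈ) ,
  (λ _ → RHSᵈ⇒RHS ∘ EGE⇒RHSᵈ , RHSᵈ⇒EGE ∘ RHS⇒RHSᵈ)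
  where open MatrixProperties.Blocks.Idempotent F k m L k⊆L
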